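{- Let $Y$ be a stable graph of order $n$ whose vertices are ordered so that each cell of its vertex partition $C_1,\dots,C_t$ (vertices with equal diagonal entries of $Y$) consists of consecutive integers, and write $Y=(Y_{ij})_{i,j\in[t]}$ as a block matrix where $Y_{ij}$ is the submatrix with rows in $C_i$ and columns in $C_j$. Let $X=(X_{ij})_{i,j\in[t]}$ be any real $n\times n$ matrix partitioned into blocks in the same way. If $XY=YX$, then $X_{ij}=\mathbf 0$ for all $i\ne j$, and $X_{ii}Y_{ij}=Y_{ij}X_{jj}$ for all $i,j\in[t]$.
   Context: Labels are independent commuting indeterminates $x_0,x_1,\dots$; $\mathrm{Var}=\{x_1,x_2,\dots\}$. A graph of order $n$ is a symmetric $n\times n$ matrix over $\{x_0\}\cup\mathrm{Var}$. Matrix products are computed in the commutative polynomial ring over $\mathbb{R}$ in the indeterminates (and an extra indeterminate $\lambda$). $A\approx B$ means: $a_{ij}=a_{st}\iff b_{ij}=b_{st}$ for all $i,j,s,t$. An equivalent variable substitution replaces the entries of a matrix by variables of $\mathrm{Var}$, equal entries by equal variables and distinct by distinct. The description graph $\tilde Y$ is obtained from $\Gamma(Y)=\sum_{k=0}^{n-1}\lambda^kY^k$ ($Y^0=I$) by an equivalent variable substitution. A graph $Y$ is stable if $\tilde Y\approx Y$. -}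

module Defs where

open import Level using (Level)
open import Data.Nat using (ℕ; zero; suc; _≤_; _≟_)
open import Data.Nat.Properties using (≤-decTotalOrder)
open import Data.Fin using (Fin; toℕ)
open import Data.Fin.Properties using () renaming (_≟_ to _≟ᶠ_)
open import Data.List using (List; []; _∷_; map; concat; concatMap; upTo; allFin)
open import Data.List.Relation.Binary.Permutation.Propositional using (_↭_)
open import Data.Product using (_×_; _,_; ∃)
open import Relation.Nullary using (¬_; does)
open import Data.Bool using (if_then_else_)
open import Function.Bundles using (_⇔_)
open import Relation.Binary.PropositionalEquality using (_≡_)
open import Algebra.Bundles using (CommutativeRing)
import Data.List.Sort as Sort

open Sort ≤-decTotalOrder using (sort)

-- Labels x₀, x₁, x₂, … are encoded by their indices in ℕ; Var = {x₁, x₂, …}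
-- corresponds to indices ≥ 1.

LMat : ℕ → Set
LMat n = Fin n → Fin n → ℕ

IsGraph : ∀ {n} → LMat n → Set
IsGraph Y = ∀ i j → Y i j ≡ Y j i

Approx : ∀ {n} {A B : Set} (_~A_ : A → A → Set) (_~B_ : B → B → Set)
         (M : Fin n → Fin n → A) (N : Fin n → Fin n → B) → Set
Approx _~A_ _~B_ M N = ∀ i j s t → (M i j ~A M s t) ⇔ (N i j ~B N s t)

-- Polynomials in ℕ[λ, x₀, x₁, …] (coefficients in ℕ suffice for Γ(Y),
-- since entries of Y are single indeterminates).
-- A monomial λ^k · x_{a₁} ⋯ x_{a_m} is represented canonically as
-- (k , sorted list of the a's); a polynomial with ℕ-coefficients is a
-- list of monomials (a sum, repetitions = coefficients), and equality
-- of polynomials is bag equality (permutation) of monomial lists.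

Monomial : Set
Monomial = ℕ × List ℕ

Poly : Set
Poly = List Monomial

_≈P_ : Poly → Poly → Set
p ≈P q = p ↭ q

-- (Y^k)_{ij} over the free commutative semiring: the sum over all walks
-- of length k from i to j of the product of their labels; we list, for
-- each walk, the list of its labels.  Y^0 = I.
walks : ∀ {n} → LMat n → ℕ → Fin n → Fin n → List (List ℕ)
walks Y zero    i j = if does (i ≟ᶠ j) then ([] ∷ []) else []
walks {n} Y (suc k) i j =
  concatMap (λ l → map (Y i l ∷_) (walks Y k l j)) (allFin n)

-- Γ(Y)_{ij} = Σ_{k=0}^{n-1} λ^k (Y^k)_{ij}
Γ : ∀ {n} → LMat n → Fin n → Fin n → Poly
Γ {n} Y i j =
  concatMap (λ k → map (λ w → (k , sort w)) (walks Y k i j)) (upTo n)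

-- Ỹ is obtained from Γ(Y) by an equivalent variable substitution.
IsDescription : ∀ {n} → LMat n → LMat n → Set
IsDescription Y Yt = (∀ i j → 1 ≤ Yt i j) × Approx _≡_ _≈P_ Yt (Γ Y)

Stable : ∀ {n} → LMat n → Set
Stable Y = ∃ λ Yt → IsDescription Y Yt × Approx _≡_ _≡_ Yt Y

CellsConsecutive : ∀ {n} → LMat n → Set
CellsConsecutive Y = ∀ p q r → toℕ p ≤ toℕ q → toℕ q ≤ toℕ r →
  Y p p ≡ Y r r → Y q q ≡ Y p p

-- Products X·Y and
-- Y·X have entries that are linear forms Σ_v c_v x_v; we represent them
-- by their coefficient functions v ↦ c_v.

module _ {c ℓ : Level} (R : CommutativeRing c ℓ) where
  open CommutativeRing R

  ∑ : ∀ {n} → (Fin n → Carrier) → Carrier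
  ∑ {zero}  f = 0#
  ∑ {suc n} f = f Fin.zero + ∑ (λ i → f (Fin.suc i))
    where import Data.Fin as Fin

  -- coefficient of x_v in the indeterminate x_a
  [_≐_] : ℕ → ℕ → Carrier
  [ a ≐ v ] = if does (a ≟ v) then 1# else 0#

  inCell : ∀ {n} → LMat n → Fin n → Fin n → Carrier
  inCell Y p r = if does (Y r r ≟ Y p p) then 1# else 0#

  XY-coeff : ∀ {n} → (Fin n → Fin n → Carrier) → LMat n → Fin n → Fin n → ℕ → Carrier
  XY-coeff X Y p q v = ∑ (λ r → X p r * [ Y r q ≐ v ])

  YX-coeff : ∀ {n} → (Fin n → Fin n → Carrier) → LMat n → Fin n → Fin n → ℕ → Carrier
  YX-coeff X Y p q v = ∑ (λ r → [ Y p r ≐ v ] * X r q)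

  Commute : ∀ {n} → (Fin n → Fin n → Carrier) → LMat n → Set ℓ
  Commute X Y = ∀ p q v → XY-coeff X Y p q v ≈ YX-coeff X Y p q v

  -- For p ∈ C_i, q ∈ C_j: coefficient of x_v in the (p,q) entry of
  -- X_ii Y_ij (sum over r ∈ C_i) and of Y_ij X_jj (sum over r ∈ C_j).
  XiiYij-coeff : ∀ {n} → (Fin n → Fin n → Carrier) → LMat n → Fin n → Fin n → ℕ → Carrier
  XiiYij-coeff X Y p q v = ∑ (λ r → inCell Y p r * (X p r * [ Y r q ≐ v ]))

  YijXjj-coeff : ∀ {n} → (Fin n → Fin n → Carrier) → LMat n → Fin n → Fin n → ℕ → Carrier
  YijXjj-coeff X Y p q v = ∑ (λ r → inCell Y q r * ([ Y p r ≐ v ] * X r q))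

-- The diagonal entries of Γ(Y) are the only ones containing the
-- monomial λ⁰ = 1, so in a stable graph no off-diagonal label equals a diagonal
-- label.  Comparing the coefficient of x = Y_qq in the (p,q) entries of XY and YX
-- then gives X_pq on the left (only Y_qq carries the label x in column q) and 0
-- on the right when Y_pp ≠ Y_qq (no entry of row p carries x).  Once X vanishes
-- between cells, restricting the sums in (XY)_pq and (YX)_pq to the cells of p
-- and q changes nothing, which is the block identity X_ii Y_ij = Y_ij X_jj.
module Submission where

open import Defs
open import Level using (Level)
open import Data.Nat as ℕ using (ℕ; zero; suc)
open import Data.Fin using (Fin; punchIn) renaming (zero to fzero; suc to fsuc)
open import Data.Fin.Properties using (punchInᵢ≢i) renaming (_≟_ to _≟ᶠ_)
open import Data.Product using (_×_; _,_; proj₁)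
open import Data.Bool using (if_then_else_)
open import Data.List using ([]; _∷_; map; upTo)
open import Data.List.Relation.Unary.Any using (here; satisfied)
open import Data.List.Membership.Propositional using (_∈_; _∉_)
open import Data.List.Membership.Propositional.Properties
  using (∈-concatMap⁺; ∈-concatMap⁻; ∈-map⁺; ∈-map⁻)
open import Data.List.Relation.Binary.Permutation.Propositional using (↭-sym)
open import Data.List.Relation.Binary.Permutation.Propositional.Properties using (∈-resp-↭)
open import Relation.Nullary using (¬_; Dec; yes; no; does)
open import Relation.Nullary.Decidable using (dec-true; dec-false)
open import Relation.Binary.PropositionalEquality
  using (_≡_; _≢_; refl; sym; cong; subst)
open import Function.Base using (_∘_)
open import Function.Bundles using (Equivalence)
open import Algebra.Bundles using (CommutativeRing)
open import Data.Nat.Properties using (≤-decTotalOrder)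
import Data.List.Sort as Sort
open Sort ≤-decTotalOrder using (sort)

if-holds : ∀ {a p} {A : Set a} {P : Set p} (d : Dec P) → P →
  {x y : A} → (if does d then x else y) ≡ x
if-holds d p = cong (if_then _ else _) (dec-true d p)

if-fails : ∀ {a p} {A : Set a} {P : Set p} (d : Dec P) → ¬ P →
  {x y : A} → (if does d then x else y) ≡ y
if-fails d ¬p = cong (if_then _ else _) (dec-false d ¬p)

walks-length0-diagonal : ∀ {n} (Y : LMat n) q → walks Y 0 q q ≡ [] ∷ []
walks-length0-diagonal Y q = if-holds (q ≟ᶠ q) refl

walks-length0-offDiagonal : ∀ {n} (Y : LMat n) {s t} → s ≢ t → walks Y 0 s t ≡ []
walks-length0-offDiagonal Y {s} {t} s≢t = if-fails (s ≟ᶠ t) s≢t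

1∈Γ-diagonal : ∀ {n} (Y : LMat n) q → (0 , sort []) ∈ Γ Y q q
1∈Γ-diagonal {suc m} Y q =
  ∈-concatMap⁺ (λ k → map (λ w → (k , sort w)) (walks Y k q q)) {xs = upTo (suc m)}
    (here (∈-map⁺ (λ w → (0 , sort w)) []∈walks0))
  where
  []∈walks0 : [] ∈ walks Y 0 q q
  []∈walks0 = subst ([] ∈_) (sym (walks-length0-diagonal Y q)) (here refl)

module _ {n : ℕ} (Y : LMat n) where

  λ-free∉Γ-offDiagonal : ∀ {s t} → s ≢ t → ∀ w → (0 , w) ∉ Γ Y s t
  λ-free∉Γ-offDiagonal s≢t _ m
    with k , m′ ← satisfied (∈-concatMap⁻ _ {xs = upTo n} m)
    with w′ , w′∈walks , eq ← ∈-map⁻ _ m′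
    with refl ← cong proj₁ eq
    with () ← subst (w′ ∈_) (walks-length0-offDiagonal Y s≢t) w′∈walks

  stable⇒offDiagonal≢diagonal : Stable Y → ∀ {s t} q → s ≢ t → Y s t ≢ Y q q
  stable⇒offDiagonal≢diagonal (Yt , (_ , Yt≈Γ) , Yt≈Y) {s} {t} q s≢t Yst≡Yqq =
    λ-free∉Γ-offDiagonal s≢t (sort []) (∈-resp-↭ (↭-sym Γst↭Γqq) (1∈Γ-diagonal Y q))
    where
    Γst↭Γqq : Γ Y s t ≈P Γ Y q q
    Γst↭Γqq = Equivalence.to (Yt≈Γ s t q q) (Equivalence.from (Yt≈Y s t q q) Yst≡Yqq)

module _ {c ℓ : Level} (R : CommutativeRing c ℓ) where
  open CommutativeRing R hiding (refl; sym)
  open import Algebra.Properties.Semiring.Sum semiring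
    using (sum; sum-cong-≋; sum-replicate-zero; sum-remove)
  open import Relation.Binary.Reasoning.Setoid setoid

  ∑≡sum : ∀ {n} (f : Fin n → Carrier) → ∑ R f ≡ sum f
  ∑≡sum {zero}  f = refl
  ∑≡sum {suc n} f = cong (f fzero +_) (∑≡sum (λ r → f (fsuc r)))

  ∑-cong : ∀ {n} {f g : Fin n → Carrier} → (∀ r → f r ≈ g r) → ∑ R f ≈ ∑ R g
  ∑-cong {f = f} {g} f≈g = begin
    ∑ R f  ≡⟨ ∑≡sum f ⟩
    sum f  ≈⟨ sum-cong-≋ f≈g ⟩
    sum g  ≡⟨ ∑≡sum g ⟨
    ∑ R g  ∎

  ∑-zero : ∀ {n} {f : Fin n → Carrier} → (∀ r → f r ≈ 0#) → ∑ R f ≈ 0#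
  ∑-zero {n} {f} f≈0 = begin
    ∑ R f               ≡⟨ ∑≡sum f ⟩
    sum f               ≈⟨ sum-cong-≋ f≈0 ⟩
    sum {n} (λ _ → 0#)  ≈⟨ sum-replicate-zero n ⟩
    0#                  ∎

  ∑-single : ∀ {n} {f : Fin n → Carrier} q → (∀ r → r ≢ q → f r ≈ 0#) → ∑ R f ≈ f q
  ∑-single {suc n} {f} q others≈0 = begin
    ∑ R f                              ≡⟨ ∑≡sum f ⟩
    sum f                              ≈⟨ sum-remove f ⟩
    f q + sum (λ r → f (punchIn q r))  ≡⟨ cong (f q +_) (∑≡sum {n} _) ⟨
    f q + ∑ R (λ r → f (punchIn q r))  ≈⟨ +-congˡ (∑-zero (λ r → others≈0 _ (punchInᵢ≢i q r))) ⟩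
    f q + 0#                           ≈⟨ +-identityʳ (f q) ⟩
    f q                                ∎

  [≐]-same : ∀ a → [_≐_] R a a ≈ 1#
  [≐]-same a = reflexive (if-holds (a ℕ.≟ a) refl)

  [≐]-different : ∀ {a v} → a ≢ v → [_≐_] R a v ≈ 0#
  [≐]-different {a} {v} a≢v = reflexive (if-fails (a ℕ.≟ v) a≢v)

  inCell-absorbs : ∀ {n} (Y : LMat n) {p r} {x : Carrier} →
    (Y r r ≢ Y p p → x ≈ 0#) → inCell R Y p r * x ≈ x
  inCell-absorbs Y {p} {r} {x} outside⇒0 with Y r r ℕ.≟ Y p p
  ... | yes same = begin
    inCell R Y p r * x  ≡⟨ cong (_* x) (if-holds (Y r r ℕ.≟ Y p p) same) ⟩
    1# * x              ≈⟨ *-identityˡ x ⟩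
    x                   ∎
  ... | no different = begin
    inCell R Y p r * x  ≡⟨ cong (_* x) (if-fails (Y r r ℕ.≟ Y p p) different) ⟩
    0# * x              ≈⟨ zeroˡ x ⟩
    0#                  ≈⟨ outside⇒0 different ⟨
    x                   ∎

  module _ {n} {Y : LMat n} (stable : Stable Y) (X : Fin n → Fin n → Carrier) where

    XY-coeff-diagonalLabel : ∀ p q → XY-coeff R X Y p q (Y q q) ≈ X p q
    XY-coeff-diagonalLabel p q = begin
      XY-coeff R X Y p q (Y q q)       ≈⟨ ∑-single q off-q ⟩
      X p q * [_≐_] R (Y q q) (Y q q)  ≈⟨ *-congˡ ([≐]-same (Y q q)) ⟩
      X p q * 1#                       ≈⟨ *-identityʳ (X p q) ⟩
      X p q                            ∎
      where
      off-q : ∀ r → r ≢ q → X p r * [_≐_] R (Y r q) (Y q q) ≈ 0#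
      off-q r r≢q =
        trans (*-congˡ ([≐]-different (stable⇒offDiagonal≢diagonal Y stable q r≢q))) (zeroʳ _)

    YX-coeff-foreignDiagonalLabel : ∀ p q → Y p p ≢ Y q q → YX-coeff R X Y p q (Y q q) ≈ 0#
    YX-coeff-foreignDiagonalLabel p q Ypp≢Yqq = ∑-zero term≈0
      where
      Ypr≢Yqq : ∀ r → Y p r ≢ Y q q
      Ypr≢Yqq r with p ≟ᶠ r
      ... | yes refl = Ypp≢Yqq
      ... | no p≢r   = stable⇒offDiagonal≢diagonal Y stable q p≢r
      term≈0 : ∀ r → [_≐_] R (Y p r) (Y q q) * X r q ≈ 0#
      term≈0 r = trans (*-congʳ ([≐]-different (Ypr≢Yqq r))) (zeroˡ _)

    module _ (commute : Commute R X Y) where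

      commute⇒offCell≈0 : ∀ p q → Y p p ≢ Y q q → X p q ≈ 0#
      commute⇒offCell≈0 p q Ypp≢Yqq = begin
        X p q                       ≈⟨ XY-coeff-diagonalLabel p q ⟨
        XY-coeff R X Y p q (Y q q)  ≈⟨ commute p q (Y q q) ⟩
        YX-coeff R X Y p q (Y q q)  ≈⟨ YX-coeff-foreignDiagonalLabel p q Ypp≢Yqq ⟩
        0#                          ∎

      commute⇒blocks-commute : ∀ p q v → XiiYij-coeff R X Y p q v ≈ YijXjj-coeff R X Y p q v
      commute⇒blocks-commute p q v = begin
        XiiYij-coeff R X Y p q v  ≈⟨ ∑-cong (λ r → inCell-absorbs Y (X-vanishes r)) ⟩
        XY-coeff R X Y p q v      ≈⟨ commute p q v ⟩
        YX-coeff R X Y p q v      ≈⟨ ∑-cong (λ r → inCell-absorbs Y (Xrq-vanishes r)) ⟨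
        YijXjj-coeff R X Y p q v  ∎
        where
        X-vanishes : ∀ r → Y r r ≢ Y p p → X p r * [_≐_] R (Y r q) v ≈ 0#
        X-vanishes r Yrr≢Ypp =
          trans (*-congʳ (commute⇒offCell≈0 p r (Yrr≢Ypp ∘ sym))) (zeroˡ _)
        Xrq-vanishes : ∀ r → Y r r ≢ Y q q → [_≐_] R (Y p r) v * X r q ≈ 0#
        Xrq-vanishes r Yrr≢Yqq =
          trans (*-congˡ (commute⇒offCell≈0 r q Yrr≢Yqq)) (zeroʳ _)

theorem6 : ∀ {c ℓ : Level} (R : CommutativeRing c ℓ) (n : ℕ) (Y : LMat n)
  (X : Fin n → Fin n → CommutativeRing.Carrier R) →
  IsGraph Y → Stable Y → CellsConsecutive Y → Commute R X Y →
  (∀ p q → ¬ (Y p p ≡ Y q q) → CommutativeRing._≈_ R (X p q) (CommutativeRing.0# R))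
  × (∀ p q v → CommutativeRing._≈_ R (XiiYij-coeff R X Y p q v) (YijXjj-coeff R X Y p q v))
theorem6 R n Y X _ stable _ commute =
  commute⇒offCell≈0 R stable X commute , commute⇒blocks-commute R stable X commute
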